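{- Let $r,s$ be positive integers. If $\Theta_{2,2r,2s}$ is $(4:2)$-choosable, then $\Theta_{1,2r-1,2s-1}$ is $(4:2)$-choosable.
   Context: $\Theta_{a,b,c}$ denotes the graph consisting of two end vertices joined by three internally vertex-disjoint paths with $a$, $b$, $c$ edges respectively. A graph is $(4:2)$-choosable if for every assignment $L$ of $4$-element colour lists to its vertices, one can assign to each vertex $v$ a $2$-subset of $L(v)$ so that adjacent vertices receive disjoint sets. -}

module Defs where

open import Data.Nat using (ℕ; zero; suc; _≤_; _<_)
open import Data.Fin using (Fin; zero; suc)
open import Data.List using (List; length)
open import Data.Product using (Σ; _×_; ∃; ∃-syntax)
open import Data.Sum using (_⊎_)
open import Relation.Binary.PropositionalEquality using (_≡_)
open import Data.List.Relation.Unary.Unique.Propositional using (Unique)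
open import Data.List.Relation.Binary.Subset.Propositional using (_⊆_)
open import Data.List.Relation.Binary.Disjoint.Propositional using (Disjoint)

ListAssignment : (V : Set) → ℕ → Set
ListAssignment V a =
  Σ (V → List ℕ) λ L → (∀ v → length (L v) ≡ a) × (∀ v → Unique (L v))

Choosable : (V : Set) (Adj : V → V → Set) (a b : ℕ) → Set
Choosable V Adj a b =
  (L : ListAssignment V a) →
  Σ (V → List ℕ) λ C →
      (∀ v → C v ⊆ Data.Product.proj₁ L v)
    × (∀ v → length (C v) ≡ b)
    × (∀ v → Unique (C v))
    × (∀ u v → Adj u v → Disjoint (C u) (C v))

-- Theta graph Θ_{a,b,c}: end vertices src, tgt joined by three
-- internally disjoint paths (indexed by Fin 3) with a, b, c edges.
-- Path p with k edges has internal vertices at positions 1 … k-1.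

pathLen : ℕ → ℕ → ℕ → Fin 3 → ℕ
pathLen a b c zero = a
pathLen a b c (suc zero) = b
pathLen a b c (suc (suc zero)) = c

data ThetaV (a b c : ℕ) : Set where
  src tgt : ThetaV a b c
  inner : (p : Fin 3) (i : ℕ) → 1 ≤ i → i < pathLen a b c p → ThetaV a b c

data At {a b c : ℕ} (p : Fin 3) : ℕ → ThetaV a b c → Set where
  at-src   : At p 0 src
  at-tgt   : At p (pathLen a b c p) tgt
  at-inner : ∀ i (h₁ : 1 ≤ i) (h₂ : i < pathLen a b c p) → At p i (inner p i h₁ h₂)

Step : {a b c : ℕ} → ThetaV a b c → ThetaV a b c → Set
Step u v = ∃[ p ] ∃[ i ] (At p i u × At p (suc i) v)

ThetaAdj : {a b c : ℕ} → ThetaV a b c → ThetaV a b c → Set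
ThetaAdj u v = Step u v ⊎ Step v u

ThetaChoosable : (a b c m k : ℕ) → Set
ThetaChoosable a b c m k = Choosable (ThetaV a b c) (ThetaAdj {a} {b} {c}) m k

-- Θ_{1,2r-1,2s-1} arises from Θ_{2,2r,2s} by contracting the three edges at
-- the end vertex x into a single vertex x'.  Give x and its three neighbours
-- the list of x' and pull the other lists back.  In a (2k:k)-colouring of
-- Θ_{2,2r,2s} every neighbour of x gets exactly the complement in L(x') of
-- the colour set of x, so all three neighbours get the same set; giving that
-- set to x' and keeping the colouring elsewhere colours Θ_{1,2r-1,2s-1}.
module Submission where

open import Defs
open import Data.Nat using (ℕ; zero; suc; _+_; _*_; _∸_; _≤_; _<_; z≤n; s≤s; _≟_)
open import Data.Nat.Properties using (≤-refl; <⇒≤; <-irrelevant; ≤-pred; 1+n≰n)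
open import Data.Fin using (zero; suc)
open import Data.Fin.Properties using (injective⇒≤)
open import Data.List using (List; _∷_; length; lookup; _++_)
open import Data.List.Properties using (length-++)
open import Data.List.Relation.Unary.Any using (here; there; index)
import Data.List.Relation.Unary.All as All
open import Data.List.Relation.Unary.AllPairs using (_∷_)
open import Data.List.Relation.Unary.Unique.Propositional using (Unique)
open import Data.List.Relation.Unary.Unique.Propositional.Properties using (++⁺)
open import Data.List.Relation.Binary.Subset.Propositional using (_⊆_)
open import Data.List.Relation.Binary.Disjoint.Propositional using (Disjoint)
open import Data.List.Membership.Propositional using (_∈_; _∉_)
open import Data.List.Membership.Propositional.Properties using (∈-lookup; ∈-++⁻)
open import Data.List.Membership.Setoid.Properties using (index-injective)
open import Data.List.Membership.DecPropositional _≟_ using (_∈?_)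
open import Data.Product using (_,_)
open import Data.Sum using (inj₁; inj₂; [_,_]′)
open import Data.Empty using (⊥-elim)
open import Function using (_∘_)
open import Relation.Nullary using (yes; no)
open import Relation.Binary.PropositionalEquality using (_≡_; refl; sym; trans; cong; cong₂; subst; setoid)

unique-lookup-injective : ∀ {A : Set} {xs : List A} → Unique xs →
  ∀ {i j} → lookup xs i ≡ lookup xs j → i ≡ j
unique-lookup-injective (_ ∷ _)    {zero}  {zero}  _  = refl
unique-lookup-injective (x∉ ∷ _)   {zero}  {suc j} eq = ⊥-elim (All.lookup x∉ (∈-lookup j) eq)
unique-lookup-injective (x∉ ∷ _)   {suc i} {zero}  eq = ⊥-elim (All.lookup x∉ (∈-lookup i) (sym eq))
unique-lookup-injective (_ ∷ uniq) {suc i} {suc j} eq = cong suc (unique-lookup-injective uniq eq)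

Unique-⊆⇒length≤ : ∀ {A : Set} {xs ys : List A} → Unique xs → xs ⊆ ys → length xs ≤ length ys
Unique-⊆⇒length≤ {A} {xs} uniq xs⊆ys = injective⇒≤ {f = index ∘ position} λ {i} {j} →
  unique-lookup-injective uniq ∘ index-injective (setoid A) (position i) (position j)
  where
  position : ∀ i → lookup xs i ∈ _
  position i = xs⊆ys (∈-lookup i)

∈-complement : ∀ {S X Y : List ℕ} {e} → Unique X → Unique Y → Disjoint X Y →
  X ⊆ S → Y ⊆ S → length X + length Y ≡ length S →
  e ∈ S → e ∉ X → e ∈ Y
∈-complement {S} {X} {Y} {e} uX uY X#Y X⊆S Y⊆S sizes e∈S e∉X with e ∈? Y
... | yes e∈Y = e∈Y
... | no  e∉Y = ⊥-elim (1+n≰n (subst (_≤ length S) size (Unique-⊆⇒length≤ unique ⊆S)))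
  where
  unique : Unique (e ∷ X ++ Y)
  unique = All.tabulate (λ m eq → [ e∉X , e∉Y ]′ (∈-++⁻ X (subst (_∈ X ++ Y) (sym eq) m)))
         ∷ ++⁺ uX uY X#Y
  ⊆S : (e ∷ X ++ Y) ⊆ S
  ⊆S (here refl) = e∈S
  ⊆S (there m)   = [ X⊆S , Y⊆S ]′ (∈-++⁻ X m)
  size : length (e ∷ X ++ Y) ≡ suc (length S)
  size = cong suc (trans (length-++ X) sizes)

module Contraction (B C : ℕ) where

  Small Big : Set
  Small = ThetaV 1 B C
  Big   = ThetaV 2 (suc B) (suc C)

  pathLen-suc : ∀ p → pathLen 2 (suc B) (suc C) p ≡ suc (pathLen 1 B C p)
  pathLen-suc zero             = refl
  pathLen-suc (suc zero)       = refl
  pathLen-suc (suc (suc zero)) = refl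

  neighbour : ∀ p → 1 ≤ pathLen 1 B C p → Big
  neighbour p 1≤ = inner p 1 (s≤s z≤n) (subst (1 <_) (sym (pathLen-suc p)) (s≤s 1≤))

  embed : Small → Big
  embed src              = neighbour zero ≤-refl
  embed tgt              = tgt
  embed (inner p j _ j<) = inner p (suc j) (s≤s z≤n) (subst (suc j <_) (sym (pathLen-suc p)) (s≤s j<))

  contract : Big → Small
  contract src                          = src
  contract tgt                          = tgt
  contract (inner p (suc zero) _ _)     = src
  contract (inner p (suc (suc j)) _ j<) =
    inner p (suc j) (s≤s z≤n) (≤-pred (subst (suc (suc (suc j)) ≤_) (pathLen-suc p) j<))

  contract-embed : ∀ v → contract (embed v) ≡ v
  contract-embed src                           = refl
  contract-embed tgt                           = refl
  contract-embed (inner p (suc j) (s≤s z≤n) _) = cong (inner p (suc j) (s≤s z≤n)) (<-irrelevant _ _)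

  At-≤ : ∀ {p j} {v : Small} → At p j v → j ≤ pathLen 1 B C p
  At-≤ at-src            = z≤n
  At-≤ at-tgt            = ≤-refl
  At-≤ (at-inner _ _ j<) = <⇒≤ j<

  At-embed : ∀ {p j} {v : Small} → At p j v → 1 ≤ j → At p (suc j) (embed v)
  At-embed {p} at-tgt _ = subst (λ k → At {2} {suc B} {suc C} p k tgt) (pathLen-suc p) at-tgt
  At-embed (at-inner i _ _) _ = at-inner (suc i) _ _

  module Restriction {k} (L : Small → List ℕ)
    (L-length : ∀ v → length (L v) ≡ k + k)
    (col : Big → List ℕ)
    (col⊆L : ∀ v → col v ⊆ L (contract v))
    (col-length : ∀ v → length (col v) ≡ k)
    (col-unique : ∀ v → Unique (col v))
    (col-disjoint : ∀ u v → ThetaAdj u v → Disjoint (col u) (col v))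
    where

    neighbours-agree : ∀ p 1≤ → col (embed src) ⊆ col (neighbour p 1≤)
    neighbours-agree p 1≤ {e} e∈ =
      ∈-complement (col-unique src) (col-unique (neighbour p 1≤)) (col-disjoint _ _ (from-src p 1≤))
        (col⊆L src) (col⊆L (neighbour p 1≤))
        (trans (cong₂ _+_ (col-length src) (col-length (neighbour p 1≤))) (sym (L-length src)))
        (col⊆L (embed src) e∈) (λ e∈src → col-disjoint _ _ (from-src zero ≤-refl) (e∈src , e∈))
      where
      from-src : ∀ q 1≤ → ThetaAdj src (neighbour q 1≤)
      from-src q _ = inj₁ (q , 0 , at-src , at-inner 1 _ _)

    embed-step : ∀ {u v} → Step u v → Disjoint (col (embed u)) (col (embed v))
    embed-step (p , _ , at-src , at-v) (e∈u , e∈v) =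
      col-disjoint (neighbour p (At-≤ at-v)) _ (inj₁ (p , 1 , at-inner 1 _ _ , At-embed at-v (s≤s z≤n)))
        (neighbours-agree p (At-≤ at-v) e∈u , e∈v)
    embed-step (p , _ , at-tgt , at-v) = ⊥-elim (1+n≰n (At-≤ at-v))
    embed-step (p , _ , at-inner i 1≤i i< , at-v) =
      col-disjoint _ _ (inj₁ (p , suc i , At-embed (at-inner i 1≤i i<) 1≤i , At-embed at-v (s≤s z≤n)))

    embed-disjoint : ∀ u v → ThetaAdj u v → Disjoint (col (embed u)) (col (embed v))
    embed-disjoint u v (inj₁ step)           = embed-step step
    embed-disjoint u v (inj₂ step) (eu , ev) = embed-step step (ev , eu)

  contract-choosable : ∀ k → ThetaChoosable 2 (suc B) (suc C) (k + k) k → ThetaChoosable 1 B C (k + k) k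
  contract-choosable k big (L , L-length , L-unique)
    with big (L ∘ contract , L-length ∘ contract , L-unique ∘ contract)
  ... | col , col⊆L , col-length , col-unique , col-disjoint =
    col ∘ embed ,
    (λ v → subst (λ w → col (embed v) ⊆ L w) (contract-embed v) (col⊆L (embed v))) ,
    col-length ∘ embed ,
    col-unique ∘ embed ,
    Restriction.embed-disjoint L L-length col col⊆L col-length col-unique col-disjoint

corollary4p2 : (r s : ℕ) → 1 ≤ r → 1 ≤ s →
    ThetaChoosable 2 (2 * r) (2 * s) 4 2 →
    ThetaChoosable 1 (2 * r ∸ 1) (2 * s ∸ 1) 4 2
-- Both 2 * suc r ≡ suc (2 * suc r ∸ 1) and 2 + 2 ≡ 4 hold by computation.
corollary4p2 (suc r) (suc s) _ _ = Contraction.contract-choosable (2 * suc r ∸ 1) (2 * suc s ∸ 1) 2
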